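{- There is a signature $\Sigma$ and a sentence $\phi$ of $\mathsf{InqBQ}$ in $\Sigma$ such that there is no sentence $\phi^*$ of two-sorted first-order logic in the signature $\Sigma^*$ with the property that for every first-order information model $M$ for $\Sigma$: $M\models\phi$ iff $M^*\models\phi^*$.
   Context: $\mathsf{InqBQ}$ formulas: $\phi ::= p \mid \bot \mid (\phi\wedge\phi)\mid(\phi\veebar\phi)\mid(\phi\to\phi)\mid\forall x\phi\mid\exists^{\mathrm{i}}x\phi$, with $p$ first-order atoms. A first-order information model for $\Sigma$ is $M=(W,D,I)$ with non-empty sets $W$ (worlds) and $D$ (individuals), and for each $w\in W$ an interpretation $I_w$ assigning to each $n$-ary relation symbol $R$ a relation $R_w\subseteq D^n$ and to each $n$-ary function symbol $f$ a function $f_w:D^n\to D$. Terms are evaluated at world $w$ and assignment $g$ as $[t]^g_w$. Support $M,s\models_g\phi$ for a state $s\subseteq W$: $M,s\models_g R(t_1,\dots,t_n)$ iff $([t_1]^g_w,\dots,[t_n]^g_w)\in R_w$ for all $w\in s$; $M,s\models_g t_1=t_2$ iff $[t_1]^g_w=[t_2]^g_w$ for all $w\in s$; $\bot$ iff $s=\emptyset$; $\wedge$ conjunction; $\phi\veebar\psi$ iff $\phi$ or $\psi$ supported; $\phi\to\psi$ iff every $t\subseteq s$ supporting $\phi$ supports $\psi$; $\forall x\phi$ iff $M,s\models_{g[x\mapsto d]}\phi$ for all $d\in D$; $\exists^{\mathrm{i}}x\phi$ iff for some $d\in D$. For a sentence, $M\models\phi$ means $M,W\models_g\phi$ (for any $g$).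 The signature $\Sigma^*$ is two-sorted, with sorts $\mathtt{w}$ (worlds) and $\mathtt{e}$ (individuals): each $n$-ary predicate $P\in\Sigma$ yields an $(n+1)$-ary predicate $P^*$ whose first argument has sort $\mathtt{w}$ and the others sort $\mathtt{e}$; each $n$-ary function symbol $f\in\Sigma$ yields an $(n+1)$-ary function symbol $f^*$ with first argument of sort $\mathtt{w}$ and other arguments and output of sort $\mathtt{e}$. The encoding $M^*=(W,D,I^*)$ is the two-sorted structure with $(w,\bar d)\in I^*(P^*)$ iff $\bar d\in I_w(P)$ and $I^*(f^*)(w,\bar d)=I_w(f)(\bar d)$. -}

module Defs where

import Level
open import Level using (Lift; lift; 0ℓ)
open import Data.Nat using (ℕ; suc)
open import Data.Fin using (Fin; zero; suc)
open import Data.Vec using (Vec; []; _∷_)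
open import Data.Unit using (⊤)
open import Data.Empty using (⊥)
open import Data.Product using (_×_)
import Data.Product
open import Data.Sum using (_⊎_)
open import Relation.Nullary using (¬_)
open import Relation.Binary.PropositionalEquality using (_≡_)

record Signature : Set₁ where
  field
    Rel   : Set
    relAr : Rel → ℕ
    Fun   : Set
    funAr : Fun → ℕ

open Signature

-- Extending an assignment (de Bruijn: variable zero is the newest)
_∷ᵍ_ : ∀ {n} {A : Set} → A → (Fin n → A) → Fin (suc n) → A
(a ∷ᵍ g) zero    = a
(a ∷ᵍ g) (suc i) = g i

data Term (S : Signature) (n : ℕ) : Set where
  var : Fin n → Term S n
  app : (f : Fun S) → Vec (Term S n) (funAr S f) → Term S n

data Formula (S : Signature) (n : ℕ) : Set where
  rel  : (R : Rel S) → Vec (Term S n) (relAr S R) → Formula S n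
  eq   : Term S n → Term S n → Formula S n
  bot  : Formula S n
  _∧ᵢ_ : Formula S n → Formula S n → Formula S n
  _⩒_  : Formula S n → Formula S n → Formula S n
  _⇒_  : Formula S n → Formula S n → Formula S n
  ∀ᵢ   : Formula S (suc n) → Formula S n
  ∃ⁱ   : Formula S (suc n) → Formula S n

Sentence : Signature → Set
Sentence S = Formula S 0

-- First-order information models M = (W, D, I), W and D non-empty

record InfoModel (S : Signature) : Set₁ where
  field
    W    : Set
    D    : Set
    w₀   : W
    d₀   : D
    relI : W → (R : Rel S) → Vec D (relAr S R) → Set
    funI : W → (f : Fun S) → Vec D (funAr S f) → D

module _ {S : Signature} (M : InfoModel S) where
  open InfoModel M

  mutual
    evalT : ∀ {n} → W → (Fin n → D) → Term S n → D
    evalT w g (var i)    = g i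
    evalT w g (app f ts) = funI w f (evalTs w g ts)

    evalTs : ∀ {n k} → W → (Fin n → D) → Vec (Term S n) k → Vec D k
    evalTs w g []       = []
    evalTs w g (t ∷ ts) = evalT w g t ∷ evalTs w g ts

  State : Set₁
  State = W → Set

  support : ∀ {n} → (Fin n → D) → State → Formula S n → Set₁
  support g s (rel R ts) = Lift (Level.suc 0ℓ) (∀ w → s w → relI w R (evalTs w g ts))
  support g s (eq t u)   = Lift (Level.suc 0ℓ) (∀ w → s w → evalT w g t ≡ evalT w g u)
  support g s bot        = Lift (Level.suc 0ℓ) (∀ w → ¬ s w)
  support g s (φ ∧ᵢ ψ)   = support g s φ × support g s ψ
  support g s (φ ⩒ ψ)    = support g s φ ⊎ support g s ψ
  support g s (φ ⇒ ψ)    = (t : State) → (∀ w → t w → s w) →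
                           support g t φ → support g t ψ
  support g s (∀ᵢ φ)     = (d : D) → support (d ∷ᵍ g) s φ
  support g s (∃ⁱ φ)     = Data.Product.Σ D λ d → support (d ∷ᵍ g) s φ

  _⊨_ : Sentence S → Set₁
  _⊨_ φ = support (λ ()) (λ _ → ⊤) φ

-- Terms of sort w are world variables only (Σ* has no function symbols
-- with output sort w); terms of sort e are e-variables or f*(w, e₁..eₖ).

data ETerm (S : Signature) (m n : ℕ) : Set where
  var : Fin n → ETerm S m n
  app : (f : Fun S) → Fin m → Vec (ETerm S m n) (funAr S f) → ETerm S m n

-- Primitive connectives ⊥, ∧, →, ∀ (for each sort) and equality for each
-- sort; ¬, ∨, ∃, ↔ are the usual classical abbreviations.
data FOFormula (S : Signature) (m n : ℕ) : Set where
  rel  : (R : Rel S) → Fin m → Vec (ETerm S m n) (relAr S R) → FOFormula S m n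
  eqw  : Fin m → Fin m → FOFormula S m n
  eqe  : ETerm S m n → ETerm S m n → FOFormula S m n
  bot  : FOFormula S m n
  _∧ᶠ_ : FOFormula S m n → FOFormula S m n → FOFormula S m n
  _⇒ᶠ_ : FOFormula S m n → FOFormula S m n → FOFormula S m n
  ∀w   : FOFormula S (suc m) n → FOFormula S m n
  ∀e   : FOFormula S m (suc n) → FOFormula S m n

FOSentence : Signature → Set
FOSentence S = FOFormula S 0 0

record Structure* (S : Signature) : Set₁ where
  field
    Sw   : Set
    Se   : Set
    relS : (R : Rel S) → Sw → Vec Se (relAr S R) → Set
    funS : (f : Fun S) → Sw → Vec Se (funAr S f) → Se

module _ {S : Signature} (A : Structure* S) where
  open Structure* A

  mutual
    evalE : ∀ {m n} → (Fin m → Sw) → (Fin n → Se) → ETerm S m n → Se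
    evalE gw ge (var i)      = ge i
    evalE gw ge (app f v ts) = funS f (gw v) (evalEs gw ge ts)

    evalEs : ∀ {m n k} → (Fin m → Sw) → (Fin n → Se) → Vec (ETerm S m n) k → Vec Se k
    evalEs gw ge []       = []
    evalEs gw ge (t ∷ ts) = evalE gw ge t ∷ evalEs gw ge ts

  sat : ∀ {m n} → (Fin m → Sw) → (Fin n → Se) → FOFormula S m n → Set
  sat gw ge (rel R v ts) = relS R (gw v) (evalEs gw ge ts)
  sat gw ge (eqw u v)    = gw u ≡ gw v
  sat gw ge (eqe t u)    = evalE gw ge t ≡ evalE gw ge u
  sat gw ge bot          = ⊥
  sat gw ge (φ ∧ᶠ ψ)     = sat gw ge φ × sat gw ge ψ
  sat gw ge (φ ⇒ᶠ ψ)     = sat gw ge φ → sat gw ge ψ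
  sat gw ge (∀w φ)       = (w : Sw) → sat (w ∷ᵍ gw) ge φ
  sat gw ge (∀e φ)       = (d : Se) → sat gw (d ∷ᵍ ge) φ

  _⊨*_ : FOSentence S → Set
  _⊨*_ φ = sat (λ ()) (λ ()) φ

_* : ∀ {S} → InfoModel S → Structure* S
M * = record
  { Sw   = W
  ; Se   = D
  ; relS = λ R w ds → relI w R ds
  ; funS = λ f w ds → funI w f ds
  }
  where open InfoModel M

{-# OPTIONS --safe #-}
-- In the graph model on a set A the worlds are the pairs (x , y), each making the binary
-- predicate G true of exactly that pair. Information states are thus binary relations on A,
-- and the inquisitive implication quantifies over all of them; this second-order quantifier
-- lets an InqBQ sentence express Dedekind finiteness, true on every Fin n but false on ℕ.
-- The two-sorted encoding of a graph model, in contrast, is interpretable in the pure set A,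
-- so by an Ehrenfeucht–Fraïssé argument (a world being played as two individuals) a
-- first-order sentence of quantifier rank r has the same truth value in the encodings of
-- any two graph models on sets with at least r elements.
module Submission where

open import Defs
open import Data.Product using (Σ-syntax)
open import Relation.Nullary using (¬_)
open import Function.Bundles using (_⇔_)

open import Level using (Lift; lift; lower; 0ℓ) renaming (suc to lsuc)
open import Data.Nat using (ℕ; zero; suc; pred; _+_; _⊔_; _≤_; _<_)
open import Data.Nat.Properties as ℕ
  using (≤-trans; +-monoʳ-≤; +-suc; m≤m⊔n; m≤n⊔m; m+n≤o⇒m≤o; n≤1+n)
open import Data.Fin using (Fin; zero; suc; #_; _↑ʳ_; punchOut)
open import Data.Fin.Properties as Fin
  using (any?; ¬∀⟶∃¬; <⇒notInjective; punchOut-injective; toℕ-injective)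
open import Data.Vec using (Vec; []; _∷_)
open import Data.Unit using (⊤; tt)
open import Data.Empty using (⊥; ⊥-elim)
open import Data.Product using (∃-syntax; _×_; _,_; proj₁; proj₂; map; map₂; curry; uncurry)
open import Data.Product.Properties using (×-≡,≡→≡; ×-≡,≡←≡)
open import Function using (_∘_; id)
open import Function.Bundles using (mk⇔; module Equivalence)
open import Function.Definitions using (Injective)
open import Function.Properties.Equivalence as ⇔ using ()
open import Relation.Nullary using (yes; no; ¬?; _×-dec_)
open import Relation.Unary using (Decidable; _⊆′_; ｛_｝)
open import Relation.Binary.Definitions using (DecidableEquality)
open import Relation.Binary.PropositionalEquality
  using (_≡_; _≢_; _≗_; refl; sym; trans; cong; cong₂; subst; subst₂)

open Equivalence using (to; from)

private
  Lift₁ : Set → Set₁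
  Lift₁ = Lift (lsuc 0ℓ)

  variable
    m n k N : ℕ
    A B : Set

∷ᵍ-congʳ : {g h : Fin n → A} (a : A) → g ≗ h → a ∷ᵍ g ≗ a ∷ᵍ h
∷ᵍ-congʳ a g≗h zero    = refl
∷ᵍ-congʳ a g≗h (suc i) = g≗h i

∘-∷ᵍ : (f : A → B) (a : A) (g : Fin n → A) → f ∘ (a ∷ᵍ g) ≗ f a ∷ᵍ (f ∘ g)
∘-∷ᵍ f a g zero    = refl
∘-∷ᵍ f a g (suc i) = refl

module _ {S : Signature} (𝔄 : Structure* S) where
  open Structure* 𝔄

  mutual
    evalE-cong : {gw gw′ : Fin m → Sw} {ge ge′ : Fin n → Se} → gw ≗ gw′ → ge ≗ ge′ →
                 (t : ETerm S m n) → evalE 𝔄 gw ge t ≡ evalE 𝔄 gw′ ge′ t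
    evalE-cong gw≗ ge≗ (var i)      = ge≗ i
    evalE-cong gw≗ ge≗ (app f w ts) = cong₂ (funS f) (gw≗ w) (evalEs-cong gw≗ ge≗ ts)

    evalEs-cong : {gw gw′ : Fin m → Sw} {ge ge′ : Fin n → Se} → gw ≗ gw′ → ge ≗ ge′ →
                  (ts : Vec (ETerm S m n) k) → evalEs 𝔄 gw ge ts ≡ evalEs 𝔄 gw′ ge′ ts
    evalEs-cong gw≗ ge≗ []       = refl
    evalEs-cong gw≗ ge≗ (t ∷ ts) = cong₂ _∷_ (evalE-cong gw≗ ge≗ t) (evalEs-cong gw≗ ge≗ ts)

  sat-cong : {gw gw′ : Fin m → Sw} {ge ge′ : Fin n → Se} → gw ≗ gw′ → ge ≗ ge′ →
             (φ : FOFormula S m n) → sat 𝔄 gw ge φ → sat 𝔄 gw′ ge′ φ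
  sat-cong gw≗ ge≗ (rel R w ts) = subst₂ (relS R) (gw≗ w) (evalEs-cong gw≗ ge≗ ts)
  sat-cong gw≗ ge≗ (eqw w w′) e = trans (sym (gw≗ w)) (trans e (gw≗ w′))
  sat-cong gw≗ ge≗ (eqe t t′) e =
    trans (sym (evalE-cong gw≗ ge≗ t)) (trans e (evalE-cong gw≗ ge≗ t′))
  sat-cong gw≗ ge≗ bot          = id
  sat-cong gw≗ ge≗ (φ ∧ᶠ ψ)     = map (sat-cong gw≗ ge≗ φ) (sat-cong gw≗ ge≗ ψ)
  sat-cong gw≗ ge≗ (φ ⇒ᶠ ψ) h   =
    sat-cong gw≗ ge≗ ψ ∘ h ∘ sat-cong (sym ∘ gw≗) (sym ∘ ge≗) φ
  sat-cong gw≗ ge≗ (∀w φ) h w   = sat-cong (∷ᵍ-congʳ w gw≗) ge≗ φ (h w)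
  sat-cong gw≗ ge≗ (∀e φ) h d   = sat-cong gw≗ (∷ᵍ-congʳ d ge≗) φ (h d)

  sat-cong⇔ : {gw gw′ : Fin m → Sw} {ge ge′ : Fin n → Se} → gw ≗ gw′ → ge ≗ ge′ →
              (φ : FOFormula S m n) → sat 𝔄 gw ge φ ⇔ sat 𝔄 gw′ ge′ φ
  sat-cong⇔ gw≗ ge≗ φ = mk⇔ (sat-cong gw≗ ge≗ φ) (sat-cong (sym ∘ gw≗) (sym ∘ ge≗) φ)

BinarySig : Signature
BinarySig = record { Rel = ⊤ ; relAr = λ _ → 2 ; Fun = ⊥ ; funAr = λ () }

G : Term BinarySig n → Term BinarySig n → Formula BinarySig n
G x y = rel tt (x ∷ y ∷ [])

functional cofunctional notOnto notTotal : Sentence BinarySig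
functional   = ∀ᵢ (∃ⁱ (∀ᵢ (G (var (# 2)) (var (# 0)) ⇒ eq (var (# 0)) (var (# 1)))))
cofunctional = ∀ᵢ (∃ⁱ (∀ᵢ (G (var (# 0)) (var (# 2)) ⇒ eq (var (# 0)) (var (# 1)))))
notOnto      = ∃ⁱ (∀ᵢ (G (var (# 0)) (var (# 1)) ⇒ bot))
notTotal     = ∃ⁱ (∀ᵢ (G (var (# 1)) (var (# 0)) ⇒ bot))

dedekindFinite : Sentence BinarySig
dedekindFinite = (functional ∧ᵢ (cofunctional ∧ᵢ notOnto)) ⇒ notTotal

Functional Cofunctional NotOnto NotTotal : {A : Set} → (A → A → Set) → Set
Functional   {A} T = Σ[ f ∈ (A → A) ] ∀ x z → T x z → z ≡ f x
Cofunctional {A} T = Σ[ g ∈ (A → A) ] ∀ x z → T x z → x ≡ g z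
NotOnto          T = ∃[ z ] ∀ x → ¬ T x z
NotTotal         T = ∃[ x ] ∀ z → ¬ T x z

-- Classically equivalent to: every injection A → A is surjective.
DedekindFinite : Set → Set₁
DedekindFinite A =
  (T : A → A → Set) → Functional T → Cofunctional T → NotOnto T → NotTotal T

graphRel : A × A → Vec A 2 → Set
graphRel w (x ∷ y ∷ []) = (x , y) ≡ w

graphModel : (A : Set) → A → InfoModel BinarySig
graphModel A a = record
  { W = A × A ; D = A ; w₀ = a , a ; d₀ = a ; relI = λ w _ → graphRel w ; funI = λ _ () }

-- The support clause of `G x y ⇒ χ` in a graph model, for χ an equation or ⊥:
-- the substates supporting `G x y` are those inside the singleton {(x , y)}.
module _ {W : Set} {t : W → Set} {p : W} {Q : Set} where

  ⇒-singleton⇔ : ((t′ : W → Set) → t′ ⊆′ t → Lift₁ (t′ ⊆′ ｛ p ｝) → Lift₁ (t′ ⊆′ λ _ → Q))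
                 ⇔ (t p → Q)
  ⇒-singleton⇔ = mk⇔
    (λ t⊩ tp → lower (t⊩ ｛ p ｝ (λ { _ refl → tp }) (lift λ _ e → e)) p refl)
    (λ h _ t′⊆t (lift t′⊆p) → lift λ w t′w → h (subst t (sym (t′⊆p w t′w)) (t′⊆t w t′w)))

module GraphModel (A : Set) (a₀ : A) where
  private
    M = graphModel A a₀

  _⊩_ : (A × A → Set) → Sentence BinarySig → Set₁
  t ⊩ φ = support M (λ ()) t φ

  functional⇔ : {t : A × A → Set} → t ⊩ functional ⇔ Functional (curry t)
  functional⇔ = mk⇔ (λ t⊩ → proj₁ ∘ t⊩ , λ x z → to ⇒-singleton⇔ (proj₂ (t⊩ x) z))
                    (λ (f , T⊆f) x → f x , λ z → from ⇒-singleton⇔ (T⊆f x z))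

  cofunctional⇔ : {t : A × A → Set} → t ⊩ cofunctional ⇔ Cofunctional (curry t)
  cofunctional⇔ = mk⇔ (λ t⊩ → proj₁ ∘ t⊩ , λ x z → to ⇒-singleton⇔ (proj₂ (t⊩ z) x))
                      (λ (g , T⊆g) z → g z , λ x → from ⇒-singleton⇔ (T⊆g x z))

  notOnto⇔ : {t : A × A → Set} → t ⊩ notOnto ⇔ NotOnto (curry t)
  notOnto⇔ = mk⇔ (map₂ λ t⊩ x → to ⇒-singleton⇔ (t⊩ x)) (map₂ λ h x → from ⇒-singleton⇔ (h x))

  notTotal⇔ : {t : A × A → Set} → t ⊩ notTotal ⇔ NotTotal (curry t)
  notTotal⇔ = mk⇔ (map₂ λ t⊩ z → to ⇒-singleton⇔ (t⊩ z)) (map₂ λ h z → from ⇒-singleton⇔ (h z))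

  ⊨dedekindFinite⇔ : M ⊨ dedekindFinite ⇔ DedekindFinite A
  ⊨dedekindFinite⇔ = mk⇔
    (λ ⊨df T F C O → to notTotal⇔
       (⊨df (uncurry T) (λ _ _ → tt) (from functional⇔ F , from cofunctional⇔ C , from notOnto⇔ O)))
    (λ df t _ (F , C , O) → from notTotal⇔
       (df (curry t) (to functional⇔ F) (to cofunctional⇔ C) (to notOnto⇔ O)))

injective⇒hits : {f : Fin n → Fin n} → Injective _≡_ _≡_ f → (z : Fin n) → ¬ (∀ x → f x ≢ z)
injective⇒hits {suc n} {f} f-inj z f≢z = <⇒notInjective ℕ.≤-refl punchOut∘f-inj
  where
  punchOut∘f-inj : Injective _≡_ _≡_ (λ x → punchOut (f≢z x ∘ sym))
  punchOut∘f-inj = f-inj ∘ punchOut-injective (f≢z _ ∘ sym) (f≢z _ ∘ sym)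

Fin-dedekindFinite : DedekindFinite (Fin n)
Fin-dedekindFinite {n} T (f , T⊆f) (g , T⊆g) (z₀ , z₀∉ran) =
  map₂ (λ ¬good z Txz → ¬good (good Txz)) (¬∀⟶∃¬ n Good good? all-good-impossible)
  where
  Good : Fin n → Set
  Good x = g (f x) ≡ x × f x ≢ z₀

  good? : Decidable Good
  good? x = (g (f x) Fin.≟ x) ×-dec ¬? (f x Fin.≟ z₀)

  good : ∀ {x z} → T x z → Good x
  good {x} Txz = trans (cong g (sym (T⊆f _ _ Txz))) (sym (T⊆g _ _ Txz))
               , λ fx≡z₀ → z₀∉ran x (subst (T x) (trans (T⊆f _ _ Txz) fx≡z₀) Txz)

  all-good-impossible : ¬ (∀ x → Good x)
  all-good-impossible all-good = injective⇒hits f-inj z₀ (proj₂ ∘ all-good)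
    where
    f-inj : Injective _≡_ _≡_ f
    f-inj {x} {y} fx≡fy =
      trans (sym (proj₁ (all-good x))) (trans (cong g fx≡fy) (proj₁ (all-good y)))

ℕ-notDedekindFinite : ¬ DedekindFinite ℕ
ℕ-notDedekindFinite df =
  let x , x∉dom = df (λ x z → z ≡ suc x)
                     (suc , λ _ _ → id) (pred , λ { _ _ refl → refl }) (0 , λ _ ())
  in x∉dom (suc x) refl

FreshBelow : ℕ → Set → Set
FreshBelow N A = ∀ {k} → k < N → (u : Fin k → A) → ∃[ a ] (∀ i → u i ≢ a)

injection⇒freshBelow : DecidableEquality A → {ι : Fin N → A} → Injective _≡_ _≡_ ι →
                       FreshBelow N A
injection⇒freshBelow {A} {N} _≟_ {ι} ι-inj {k} k<N u =
  map ι (λ ¬hit i ui≡ιa → ¬hit (i , ui≡ιa)) (¬∀⟶∃¬ N Hit hit? all-hit-impossible)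
  where
  Hit : Fin N → Set
  Hit a = ∃[ i ] u i ≡ ι a

  hit? : Decidable Hit
  hit? a = any? λ i → u i ≟ ι a

  all-hit-impossible : ¬ (∀ a → Hit a)
  all-hit-impossible all-hit = <⇒notInjective k<N preimage-inj
    where
    preimage-inj : Injective _≡_ _≡_ (proj₁ ∘ all-hit)
    preimage-inj {a} {b} e =
      ι-inj (trans (sym (proj₂ (all-hit a))) (trans (cong u e) (proj₂ (all-hit b))))

SameEqualities : (Fin k → A) → (Fin k → B) → Set
SameEqualities u v = ∀ i j → u i ≡ u j ⇔ v i ≡ v j

SameEqualities-sym : {u : Fin k → A} {v : Fin k → B} → SameEqualities u v → SameEqualities v u
SameEqualities-sym s i j = ⇔.sym (s i j)

∷-SameEqualities : {u : Fin k → A} {v : Fin k → B} {a : A} {b : B} → SameEqualities u v →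
                   (∀ i → u i ≡ a ⇔ v i ≡ b) → SameEqualities (a ∷ᵍ u) (b ∷ᵍ v)
∷-SameEqualities s h zero    zero    = mk⇔ (λ _ → refl) (λ _ → refl)
∷-SameEqualities s h zero    (suc j) = mk⇔ (sym ∘ to (h j) ∘ sym) (sym ∘ from (h j) ∘ sym)
∷-SameEqualities s h (suc i) zero    = h i
∷-SameEqualities s h (suc i) (suc j) = s i j

pair-transfer : {u : Fin k → A} {v : Fin k → B} → SameEqualities u v → ∀ {i j i′ j′} →
                (u i , u j) ≡ (u i′ , u j′) → (v i , v j) ≡ (v i′ , v j′)
pair-transfer s = ×-≡,≡→≡ ∘ map (to (s _ _)) (to (s _ _)) ∘ ×-≡,≡←≡

extend : DecidableEquality B → {u : Fin k → A} {v : Fin k → B} → SameEqualities u v →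
         ∃[ a′ ] (∀ i → u i ≢ a′) → (b : B) → ∃[ a ] SameEqualities (a ∷ᵍ u) (b ∷ᵍ v)
extend _≟_ {u} {v} s (a′ , a′∉u) b with any? (λ i → v i ≟ b)
... | yes (i , vi≡b) =
  u i , ∷-SameEqualities s λ j → subst (λ c → u j ≡ u i ⇔ v j ≡ c) vi≡b (s j i)
... | no b∉v =
  a′ , ∷-SameEqualities s λ j → mk⇔ (⊥-elim ∘ a′∉u j) (⊥-elim ∘ b∉v ∘ (j ,_))

-- A world quantifier counts twice: in a graph model it binds a pair of individuals.
rank : {S : Signature} → FOFormula S m n → ℕ
rank (φ ∧ᶠ ψ) = rank φ ⊔ rank ψ
rank (φ ⇒ᶠ ψ) = rank φ ⊔ rank ψ
rank (∀w φ)   = 2 + rank φ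
rank (∀e φ)   = 1 + rank φ
rank _        = 0

record Reading (m n k : ℕ) : Set where
  field
    worlds   : Fin m → Fin k × Fin k
    elements : Fin n → Fin k

open Reading

worldsOf : (Fin k → A) → Reading m n k → Fin m → A × A
worldsOf u r = map u u ∘ worlds r

elementsOf : (Fin k → A) → Reading m n k → Fin n → A
elementsOf u r = u ∘ elements r

emptyReading : Reading 0 0 0
emptyReading = record { worlds = λ () ; elements = λ () }

pushElement : Reading m n k → Reading m (suc n) (suc k)
pushElement r = record
  { worlds   = map suc suc ∘ worlds r
  ; elements = zero ∷ᵍ (suc ∘ elements r)
  }

pushWorld : Reading m n k → Reading (suc m) n (suc (suc k))
pushWorld r = record
  { worlds   = (suc zero , zero) ∷ᵍ (map (2 ↑ʳ_) (2 ↑ʳ_) ∘ worlds r)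
  ; elements = (2 ↑ʳ_) ∘ elements r
  }

record LargeSet (N : ℕ) : Set₁ where
  field
    Carrier : Set
    point   : Carrier
    _≟_     : DecidableEquality Carrier
    fresh   : FreshBelow N Carrier

  structure : Structure* BinarySig
  structure = graphModel Carrier point *

  Holds : (Fin k → Carrier) → Reading m n k → FOFormula BinarySig m n → Set
  Holds u r ψ = sat structure (worldsOf u r) (elementsOf u r) ψ

  Holds-pushElement : {u : Fin k → Carrier} {r : Reading m n k} {a : Carrier}
                      (ψ : FOFormula BinarySig m (suc n)) →
                      sat structure (worldsOf u r) (a ∷ᵍ elementsOf u r) ψ
                      ⇔ Holds (a ∷ᵍ u) (pushElement r) ψ
  Holds-pushElement {u = u} {r} {a} =
    sat-cong⇔ structure (λ _ → refl) (sym ∘ ∘-∷ᵍ (a ∷ᵍ u) zero (suc ∘ elements r))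

  Holds-pushWorld : {u : Fin k → Carrier} {r : Reading m n k} {a₁ a₂ : Carrier}
                    (ψ : FOFormula BinarySig (suc m) n) →
                    sat structure ((a₁ , a₂) ∷ᵍ worldsOf u r) (elementsOf u r) ψ
                    ⇔ Holds (a₂ ∷ᵍ (a₁ ∷ᵍ u)) (pushWorld r) ψ
  Holds-pushWorld {u = u} {r} {a₁} {a₂} =
    sat-cong⇔ structure (sym ∘ ∘-∷ᵍ (map u′ u′) _ _) (λ _ → refl)
    where u′ = a₂ ∷ᵍ (a₁ ∷ᵍ u)

⊔-boundˡ : ∀ k {a b} → k + (a ⊔ b) ≤ N → k + a ≤ N
⊔-boundˡ k = ≤-trans (+-monoʳ-≤ k (m≤m⊔n _ _))

⊔-boundʳ : ∀ k {a b} → k + (a ⊔ b) ≤ N → k + b ≤ N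
⊔-boundʳ k {a} = ≤-trans (+-monoʳ-≤ k (m≤n⊔m a _))

push-bound : ∀ k {d} → k + suc d ≤ N → suc k + d ≤ N
push-bound {N} k {d} = subst (_≤ N) (+-suc k d)

push-bound⇒< : ∀ k {d} → k + suc d ≤ N → k < N
push-bound⇒< k bd = m+n≤o⇒m≤o (suc k) (push-bound k bd)

module _ {N : ℕ} where
  open LargeSet using (Carrier; fresh; _≟_; structure; Holds; Holds-pushElement; Holds-pushWorld)

  transfer : (𝔸 𝔹 : LargeSet N) (ψ : FOFormula BinarySig m n) (r : Reading m n k)
             {u : Fin k → Carrier 𝔸} {v : Fin k → Carrier 𝔹} →
             SameEqualities u v → k + rank ψ ≤ N → Holds 𝔸 u r ψ → Holds 𝔹 v r ψ
  transfer 𝔸 𝔹 (rel _ _ (var _ ∷ var _ ∷ [])) r s _ = pair-transfer s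
  transfer 𝔸 𝔹 (rel _ _ (app () _ _ ∷ _))
  transfer 𝔸 𝔹 (rel _ _ (var _ ∷ app () _ _ ∷ _))
  transfer 𝔸 𝔹 (eqw _ _) r s _ = pair-transfer s
  transfer 𝔸 𝔹 (eqe (var _) (var _)) r s _ = to (s _ _)
  transfer 𝔸 𝔹 (eqe (app () _ _) _)
  transfer 𝔸 𝔹 (eqe (var _) (app () _ _))
  transfer 𝔸 𝔹 bot r s _ = id
  transfer {k = k} 𝔸 𝔹 (φ ∧ᶠ ψ) r s bd =
    map (transfer 𝔸 𝔹 φ r s (⊔-boundˡ k bd)) (transfer 𝔸 𝔹 ψ r s (⊔-boundʳ k bd))
  transfer {k = k} 𝔸 𝔹 (φ ⇒ᶠ ψ) r s bd h =
    transfer 𝔸 𝔹 ψ r s (⊔-boundʳ k bd) ∘ h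
    ∘ transfer 𝔹 𝔸 φ r (SameEqualities-sym s) (⊔-boundˡ k bd)
  transfer {k = k} 𝔸 𝔹 (∀e ψ) r {u} s bd h b =
    let a , s′ = extend (_≟_ 𝔹) s (fresh 𝔸 (push-bound⇒< k bd) u) b
    in from (Holds-pushElement 𝔹 ψ)
         (transfer 𝔸 𝔹 ψ (pushElement r) s′ (push-bound k bd)
           (to (Holds-pushElement 𝔸 ψ) (h a)))
  transfer {k = k} 𝔸 𝔹 (∀w ψ) r {u} s bd h (b₁ , b₂) =
    let a₁ , s₁ = extend (_≟_ 𝔹) s (fresh 𝔸 (push-bound⇒< k bd) u) b₁
        a₂ , s₂ = extend (_≟_ 𝔹) s₁ (fresh 𝔸 (push-bound⇒< (suc k) (push-bound k bd)) (a₁ ∷ᵍ u)) b₂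
    in from (Holds-pushWorld 𝔹 ψ)
         (transfer 𝔸 𝔹 ψ (pushWorld r) s₂ (push-bound (suc k) (push-bound k bd))
           (to (Holds-pushWorld 𝔸 ψ) (h (a₁ , a₂))))

  ⊨*-transfer : (𝔸 𝔹 : LargeSet N) (φ : FOSentence BinarySig) → rank φ ≤ N →
                structure 𝔸 ⊨* φ → structure 𝔹 ⊨* φ
  -- The sat-cong steps only trade the empty assignments of _⊨*_ for those of the empty
  -- reading: distinct absurd lambdas are not definitionally equal.
  ⊨*-transfer 𝔸 𝔹 φ bd =
    sat-cong (structure 𝔹) (λ ()) (λ ()) φ
    ∘ transfer 𝔸 𝔹 φ emptyReading {λ ()} {λ ()} (λ ()) bd
    ∘ sat-cong (structure 𝔸) {gw′ = worldsOf (λ ()) emptyReading} {ge′ = λ ()} (λ ()) (λ ()) φ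

Fin-largeSet : ∀ r → LargeSet (suc r)
Fin-largeSet r = record
  { Carrier = Fin (suc r) ; point = zero ; _≟_ = Fin._≟_
  ; fresh = injection⇒freshBelow Fin._≟_ id }

ℕ-largeSet : ∀ N → LargeSet N
ℕ-largeSet N = record
  { Carrier = ℕ ; point = 0 ; _≟_ = ℕ._≟_
  ; fresh = injection⇒freshBelow ℕ._≟_ toℕ-injective }

theorem4 : Σ[ S ∈ Signature ] Σ[ φ ∈ Sentence S ]
               ¬ (Σ[ φ* ∈ FOSentence S ]
                   ((M : InfoModel S) → (M ⊨ φ) ⇔ ((M *) ⊨* φ*)))
theorem4 = BinarySig , dedekindFinite , λ (φ* , defines) →
  let r = rank φ*
      Fin⊨φ* = to (defines (graphModel (Fin (suc r)) zero))
                  (from (GraphModel.⊨dedekindFinite⇔ (Fin (suc r)) zero) Fin-dedekindFinite)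
      ℕ⊨φ* = ⊨*-transfer (Fin-largeSet r) (ℕ-largeSet (suc r)) φ* (n≤1+n r) Fin⊨φ*
  in ℕ-notDedekindFinite
       (to (GraphModel.⊨dedekindFinite⇔ ℕ 0) (from (defines (graphModel ℕ 0)) ℕ⊨φ*))
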